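{- Let $n, r \geq 1$. Then \[ \mathcal{S}_{(r,n)}(x) + x^n \mathcal{S}^\star_{(n,r)}(x) = (-1)^r (x-1)^{r+n} \binom{r+n}{r}^{ -1} + x^n, \] where $\mathcal{S}^\star_{(n,r)}(x) = x^r \mathcal{S}_{(n,r)}(x^{ -1})$.
   Context: For integers $n, r \geq 0$, $\mathcal{S}_{(r,n)}(x) = \sum_{k=0}^{n} \binom{n}{k} (-1)^k x^{n-k} \binom{r+k}{r}^{ -1} \in \mathbb{Q}[x]$, a polynomial of degree $n$. Its reciprocal polynomial is $\mathcal{S}^\star_{(r,n)}(x) = x^n \mathcal{S}_{(r,n)}(x^{ -1})$. -}

module Defs where

open import Data.Nat as ℕ using (ℕ; zero; suc; _≤?_; _∸_)
open import Data.Nat.Combinatorics using (_C_)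
open import Data.Integer using (+_)
open import Data.Rational as ℚ using (ℚ; 0ℚ; 1ℚ; _+_; _*_; -_; 1/_; _/_; ≢-nonZero)
open import Relation.Nullary using (yes; no)
open import Relation.Binary.PropositionalEquality using (_≡_)

-- Polynomials over ℚ, represented by their coefficient sequence:
-- p k is the coefficient of x^k.  (All polynomials built below have finite support.)
Poly : Set
Poly = ℕ → ℚ

_≈ₚ_ : Poly → Poly → Set
p ≈ₚ q = ∀ k → p k ≡ q k

constP : ℚ → Poly
constP c zero    = c
constP c (suc k) = 0ℚ

X : Poly
X zero          = 0ℚ
X (suc zero)    = 1ℚ
X (suc (suc k)) = 0ℚ

_+ₚ_ : Poly → Poly → Poly
(p +ₚ q) k = p k + q k

_·ₚ_ : ℚ → Poly → Poly
(c ·ₚ p) k = c * p k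

-- Cauchy product: coefficient k is Σ_{i=0}^{k} p i * q (k - i)
convAux : Poly → Poly → ℕ → ℕ → ℚ
convAux p q k zero    = p 0 * q k
convAux p q k (suc i) = p (suc i) * q (k ∸ suc i) + convAux p q k i

_*ₚ_ : Poly → Poly → Poly
(p *ₚ q) k = convAux p q k k

_^ₚ_ : Poly → ℕ → Poly
p ^ₚ zero  = constP 1ℚ
p ^ₚ suc n = p *ₚ (p ^ₚ n)

sumP : ℕ → (ℕ → Poly) → Poly
sumP zero    f = f 0
sumP (suc n) f = sumP n f +ₚ f (suc n)

sign : ℕ → ℚ
sign zero    = 1ℚ
sign (suc k) = - sign k

ℕ→ℚ : ℕ → ℚ
ℕ→ℚ m = (+ m) / 1

-- multiplicative inverse of a rational (only applied to nonzero binomial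
-- coefficients below; the value at 0 is an irrelevant convention)
inv : ℚ → ℚ
inv q with q ℚ.≟ 0ℚ
... | yes _  = 0ℚ
... | no q≢0 = 1/_ q {{≢-nonZero q≢0}}

S : ℕ → ℕ → Poly
S r n = sumP n (λ k → (ℕ→ℚ (n C k) * sign k * inv (ℕ→ℚ ((r ℕ.+ k) C r))) ·ₚ (X ^ₚ (n ∸ k)))

-- reciprocal polynomial with respect to degree d:  x^d p(x^{-1}),
-- i.e. coefficient k is p (d - k) for k ≤ d and 0 otherwise
reciprocal : ℕ → Poly → Poly
reciprocal d p k with k ≤? d
... | yes _ = p (d ∸ k)
... | no _  = 0ℚ

S⋆ : ℕ → ℕ → Poly
S⋆ r n = reciprocal n (S r n)

-- Put T(r,n) = (-1)^r (x - 1)^(r+n) / C(r+n, r). The coefficient of x^(n-k) in S(r,n) is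
-- (-1)^k C(n,k) / C(r+k,r), and the trinomial identity C(n,k) C(r+n,r) = C(r+n,n-k) C(r+k,r)
-- turns it into the coefficient of x^(n-k) in T(r,n): S(r,n) and T(r,n) agree in all degrees <= n.
-- Moreover x^(r+n) T(n,r)(1/x) = T(r,n)(x), so x^n S*(n,r), the reversal of S(n,r) shifted by n,
-- agrees with T(r,n) in all degrees >= n. In degree n both S(r,n) and x^n S*(n,r) have
-- coefficient 1, which accounts for the extra x^n.

module Submission where

open import Defs
open import Data.Nat using (ℕ; _≥_; _+_)
open import Data.Nat.Combinatorics using (_C_)
open import Data.Rational using (1ℚ; -_)

open import Data.Nat as ℕ using (zero; suc; _≤_; _<_; _∸_; _!; z≤n; s≤s; NonZero)
import Data.Nat.Properties as ℕₚ
open import Data.Nat.Combinatorics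
  using (nCk≡n!/k![n-k]!; k![n∸k]!∣n!; nCk≡nC[n∸k]; nCn≡1; nCk+nC[k+1]≡[n+1]C[k+1]; k>n⇒nCk≡0)
open import Data.Nat.DivMod using (m/n*n≡m)
import Data.Nat.Tactic.RingSolver as ℕ-Solver
open import Data.Nat.Coprimality using (gcd≡1⇒coprime)
open import Data.Nat.GCD using (gcd-zeroʳ)
open import Data.Integer as ℤ using (+_)
import Data.Integer.Properties as ℤₚ
open import Data.Rational as ℚ using (ℚ; 0ℚ; mkℚ; _*_)
import Data.Rational.Properties as ℚₚ
open import Data.Rational.Solver using (module +-*-Solver)
open import Data.List using (_∷_; [])
open import Data.Product using (_×_; _,_; proj₁; proj₂)
open import Data.Sum using ([_,_]′)
open import Data.Empty using (⊥-elim)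
open import Function using (_∘_)
open import Relation.Nullary using (yes; no)
open import Relation.Binary.Definitions using (Tri; tri<; tri≈; tri>)
open import Relation.Binary.PropositionalEquality
open ≡-Reasoning
open +-*-Solver

ℕ→ℚ≡mkℚ : ∀ m → ℕ→ℚ m ≡ mkℚ (+ m) 0 (gcd≡1⇒coprime (gcd-zeroʳ m))
ℕ→ℚ≡mkℚ m = ℚₚ.normalize-coprime (gcd≡1⇒coprime (gcd-zeroʳ m))

ℕ→ℚ-homo-+ : ∀ a b → ℕ→ℚ (a + b) ≡ ℕ→ℚ a ℚ.+ ℕ→ℚ b
ℕ→ℚ-homo-+ a b rewrite ℕ→ℚ≡mkℚ a | ℕ→ℚ≡mkℚ b =
  cong₂ (λ x y → (x ℤ.+ y) ℚ./ 1) (sym (ℤₚ.*-identityʳ (+ a))) (sym (ℤₚ.*-identityʳ (+ b)))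

ℕ→ℚ-homo-* : ∀ a b → ℕ→ℚ (a ℕ.* b) ≡ ℕ→ℚ a * ℕ→ℚ b
ℕ→ℚ-homo-* a b rewrite ℕ→ℚ≡mkℚ a | ℕ→ℚ≡mkℚ b = cong (ℚ._/ 1) (sym (ℤₚ.+◃n≡+n (a ℕ.* b)))

ℕ→ℚ-≢0 : ∀ {m} → m ≢ 0 → ℕ→ℚ m ≢ 0ℚ
ℕ→ℚ-≢0 {m} m≢0 eq rewrite ℕ→ℚ≡mkℚ m = m≢0 (ℤₚ.+-injective (cong ℚ.ℚ.numerator eq))

inv-inverseʳ : ∀ {q} → q ≢ 0ℚ → q * inv q ≡ 1ℚ
inv-inverseʳ {q} q≢0 with q ℚ.≟ 0ℚ
... | yes q≡0 = ⊥-elim (q≢0 q≡0)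
... | no  q≢0′ = ℚₚ.*-inverseʳ q {{ℚ.≢-nonZero q≢0′}}

*-inv-cross : ∀ {p q r s} → q ≢ 0ℚ → s ≢ 0ℚ → p * s ≡ r * q → p * inv q ≡ r * inv s
*-inv-cross {p} {q} {r} {s} q≢0 s≢0 ps≡rq = begin
  p * inv q                           ≡⟨ sym (ℚₚ.*-identityʳ (p * inv q)) ⟩
  p * inv q * 1ℚ                      ≡⟨ cong (p * inv q *_) (sym (inv-inverseʳ s≢0)) ⟩
  p * inv q * (s * inv s)             ≡⟨ solve 4 (λ p q s t → p :* q :* (s :* t) := p :* s :* (q :* t)) refl p (inv q) s (inv s) ⟩
  p * s * (inv q * inv s)             ≡⟨ cong (_* (inv q * inv s)) ps≡rq ⟩
  r * q * (inv q * inv s)             ≡⟨ solve 4 (λ r q t u → r :* q :* (t :* u) := q :* t :* (r :* u)) refl r q (inv q) (inv s) ⟩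
  q * inv q * (r * inv s)             ≡⟨ cong (_* (r * inv s)) (inv-inverseʳ q≢0) ⟩
  1ℚ * (r * inv s)                    ≡⟨ ℚₚ.*-identityˡ (r * inv s) ⟩
  r * inv s                           ∎

sign-+ : ∀ a b → sign (a + b) ≡ sign a * sign b
sign-+ zero    b = sym (ℚₚ.*-identityˡ (sign b))
sign-+ (suc a) b = trans (cong -_ (sign-+ a b)) (ℚₚ.neg-distribˡ-* (sign a) (sign b))

sign-*-self : ∀ a → sign a * sign a ≡ 1ℚ
sign-*-self zero    = refl
sign-*-self (suc a) = trans (solve 1 (λ x → (:- x) :* (:- x) := x :* x) refl (sign a)) (sign-*-self a)

sign-parity : ∀ a b d → sign a * sign (a + (b + (d + d))) ≡ sign b
sign-parity a b d = begin
  sign a * sign (a + (b + (d + d)))          ≡⟨ cong (sign a *_) (trans (sign-+ a _) (cong (sign a *_) (sign-+ b _))) ⟩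
  sign a * (sign a * (sign b * sign (d + d))) ≡⟨ cong (λ x → sign a * (sign a * (sign b * x))) (trans (sign-+ d d) (sign-*-self d)) ⟩
  sign a * (sign a * (sign b * 1ℚ))           ≡⟨ solve 2 (λ x y → x :* (x :* (y :* con 1ℚ)) := x :* x :* y) refl (sign a) (sign b) ⟩
  sign a * sign a * sign b                    ≡⟨ cong (_* sign b) (sign-*-self a) ⟩
  1ℚ * sign b                                 ≡⟨ ℚₚ.*-identityˡ (sign b) ⟩
  sign b                                      ∎

nCk*k!*[n∸k]!≡n! : ∀ {n k} → k ≤ n → (n C k) ℕ.* (k ! ℕ.* (n ∸ k) !) ≡ n !
nCk*k!*[n∸k]!≡n! {n} {k} k≤n rewrite nCk≡n!/k![n-k]! {n} {k} k≤n =
  m/n*n≡m {{ℕₚ._!*_!≢0 k (n ∸ k)}} (k![n∸k]!∣n! k≤n)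

[a+b]Ca*a!*b!≡[a+b]! : ∀ a b → ((a + b) C a) ℕ.* (a ! ℕ.* b !) ≡ (a + b) !
[a+b]Ca*a!*b!≡[a+b]! a b =
  subst (λ c → ((a + b) C a) ℕ.* (a ! ℕ.* c !) ≡ (a + b) !) (ℕₚ.m+n∸m≡n a b) (nCk*k!*[n∸k]!≡n! (ℕₚ.m≤m+n a b))

[a+b]Ca≢0 : ∀ a b → (a + b) C a ≢ 0
[a+b]Ca≢0 a b [a+b]Ca≡0 = ℕ.≢-nonZero⁻¹ ((a + b) !) {{(a + b) ℕₚ.!≢0}} (begin
  (a + b) !                         ≡⟨ sym ([a+b]Ca*a!*b!≡[a+b]! a b) ⟩
  ((a + b) C a) ℕ.* (a ! ℕ.* b !)   ≡⟨ cong (ℕ._* (a ! ℕ.* b !)) [a+b]Ca≡0 ⟩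
  0                                 ∎)

C-complement : ∀ a b {c} → a + b ≡ c → c C a ≡ c C b
C-complement a b refl = trans (nCk≡nC[n∸k] (ℕₚ.m≤m+n a b)) (cong ((a + b) C_) (ℕₚ.m+n∸m≡n a b))

-- Both sides count the ways to split a + k + m objects into blocks of sizes a, k and m.
trinomial : ∀ a k m → ((k + m) C k) ℕ.* ((a + (k + m)) C a) ≡ ((a + (k + m)) C m) ℕ.* ((a + k) C a)
trinomial a k m = ℕₚ.*-cancelʳ-≡ _ _ (k ! ℕ.* m ! ℕ.* a !) {{factorials≢0}} (trans lhs (sym rhs))
  where
  N = a + (k + m)
  P = (k + m) C k ; Q = N C a ; R = N C m ; T = (a + k) C a
  rearrange : ∀ x y u v w → x ℕ.* y ℕ.* (u ℕ.* v ℕ.* w) ≡ y ℕ.* (w ℕ.* (x ℕ.* (u ℕ.* v)))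
  rearrange = ℕ-Solver.solve-∀
  rearrange′ : ∀ x y u v w → x ℕ.* y ℕ.* (u ℕ.* v ℕ.* w) ≡ x ℕ.* (v ℕ.* (y ℕ.* (w ℕ.* u)))
  rearrange′ = ℕ-Solver.solve-∀
  factorials≢0 : NonZero (k ! ℕ.* m ! ℕ.* a !)
  factorials≢0 = ℕₚ.m*n≢0 _ _ {{ℕₚ._!*_!≢0 k m}} {{a ℕₚ.!≢0}}
  lhs : P ℕ.* Q ℕ.* (k ! ℕ.* m ! ℕ.* a !) ≡ N !
  lhs = begin
    P ℕ.* Q ℕ.* (k ! ℕ.* m ! ℕ.* a !)     ≡⟨ rearrange P Q (k !) (m !) (a !) ⟩
    Q ℕ.* (a ! ℕ.* (P ℕ.* (k ! ℕ.* m !))) ≡⟨ cong (λ x → Q ℕ.* (a ! ℕ.* x)) ([a+b]Ca*a!*b!≡[a+b]! k m) ⟩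
    Q ℕ.* (a ! ℕ.* (k + m) !)             ≡⟨ [a+b]Ca*a!*b!≡[a+b]! a (k + m) ⟩
    N !                                   ∎
  rhs : R ℕ.* T ℕ.* (k ! ℕ.* m ! ℕ.* a !) ≡ N !
  rhs = begin
    R ℕ.* T ℕ.* (k ! ℕ.* m ! ℕ.* a !)     ≡⟨ rearrange′ R T (k !) (m !) (a !) ⟩
    R ℕ.* (m ! ℕ.* (T ℕ.* (a ! ℕ.* k !))) ≡⟨ cong (λ x → R ℕ.* (m ! ℕ.* x)) ([a+b]Ca*a!*b!≡[a+b]! a k) ⟩
    R ℕ.* (m ! ℕ.* (a + k) !)             ≡⟨ subst (λ c → (c C m) ℕ.* (m ! ℕ.* (a + k) !) ≡ c !) m+[a+k]≡N ([a+b]Ca*a!*b!≡[a+b]! m (a + k)) ⟩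
    N !                                   ∎
    where
    m+[a+k]≡N : m + (a + k) ≡ N
    m+[a+k]≡N = trans (ℕₚ.+-comm m (a + k)) (ℕₚ.+-assoc a k m)

IsMonomial : ℕ → Poly → Set
IsMonomial m p = p m ≡ 1ℚ × (∀ j → j ≢ m → p j ≡ 0ℚ)

convAux-monomial-< : ∀ {m p} → IsMonomial m p → ∀ q k i → i < m → convAux p q k i ≡ 0ℚ
convAux-monomial-< {p = p} (_ , p≡0) q k zero    i<m =
  trans (cong (_* q k) (p≡0 0 (ℕₚ.<⇒≢ i<m))) (ℚₚ.*-zeroˡ (q k))
convAux-monomial-< {p = p} mono@(_ , p≡0) q k (suc i) i<m = begin
  p (suc i) * q (k ∸ suc i) ℚ.+ convAux p q k i  ≡⟨ cong₂ ℚ._+_ (cong (_* q (k ∸ suc i)) (p≡0 (suc i) (ℕₚ.<⇒≢ i<m)))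
                                                              (convAux-monomial-< mono q k i (ℕₚ.<-trans (ℕₚ.n<1+n i) i<m)) ⟩
  0ℚ * q (k ∸ suc i) ℚ.+ 0ℚ                      ≡⟨ trans (ℚₚ.+-identityʳ (0ℚ * q (k ∸ suc i))) (ℚₚ.*-zeroˡ (q (k ∸ suc i))) ⟩
  0ℚ                                             ∎

convAux-monomial-≥ : ∀ {m p} → IsMonomial m p → ∀ q k i → m ≤ i → convAux p q k i ≡ q (k ∸ m)
convAux-monomial-≥ {p = p} (p≡1 , _) q k zero z≤n = trans (cong (_* q k) p≡1) (ℚₚ.*-identityˡ (q k))
convAux-monomial-≥ {m} {p} mono@(p≡1 , p≡0) q k (suc i) m≤1+i with m ℕ.≟ suc i
... | yes refl = begin
  p (suc i) * q (k ∸ suc i) ℚ.+ convAux p q k i  ≡⟨ cong₂ ℚ._+_ (cong (_* q (k ∸ suc i)) p≡1) (convAux-monomial-< mono q k i (ℕₚ.n<1+n i)) ⟩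
  1ℚ * q (k ∸ suc i) ℚ.+ 0ℚ                      ≡⟨ trans (ℚₚ.+-identityʳ (1ℚ * q (k ∸ suc i))) (ℚₚ.*-identityˡ (q (k ∸ suc i))) ⟩
  q (k ∸ suc i)                                  ∎
... | no m≢1+i = begin
  p (suc i) * q (k ∸ suc i) ℚ.+ convAux p q k i  ≡⟨ cong₂ ℚ._+_ (cong (_* q (k ∸ suc i)) (p≡0 (suc i) (m≢1+i ∘ sym)))
                                                              (convAux-monomial-≥ mono q k i (ℕₚ.≤-pred (ℕₚ.≤∧≢⇒< m≤1+i m≢1+i))) ⟩
  0ℚ * q (k ∸ suc i) ℚ.+ q (k ∸ m)               ≡⟨ trans (cong (ℚ._+ q (k ∸ m)) (ℚₚ.*-zeroˡ (q (k ∸ suc i)))) (ℚₚ.+-identityˡ (q (k ∸ m))) ⟩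
  q (k ∸ m)                                      ∎

monomial-*ₚ-< : ∀ {m p} → IsMonomial m p → ∀ q {k} → k < m → (p *ₚ q) k ≡ 0ℚ
monomial-*ₚ-< mono q {k} = convAux-monomial-< mono q k k

monomial-*ₚ-+ : ∀ {m p} → IsMonomial m p → ∀ q t → (p *ₚ q) (m + t) ≡ q t
monomial-*ₚ-+ {m} mono q t =
  trans (convAux-monomial-≥ mono q (m + t) (m + t) (ℕₚ.m≤m+n m t)) (cong q (ℕₚ.m+n∸m≡n m t))

X-monomial : IsMonomial 1 X
X-monomial = refl , λ where
  zero          _   → refl
  (suc zero)    1≢1 → ⊥-elim (1≢1 refl)
  (suc (suc j)) _   → refl

X^-monomial : ∀ m → IsMonomial m (X ^ₚ m)
X^-monomial zero = refl , λ where
  zero    0≢0 → ⊥-elim (0≢0 refl)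
  (suc j) _   → refl
X^-monomial (suc m) = trans (monomial-*ₚ-+ X-monomial (X ^ₚ m) m) (proj₁ (X^-monomial m)) , λ where
  zero    _       → monomial-*ₚ-< X-monomial (X ^ₚ m) (s≤s z≤n)
  (suc j) 1+j≢1+m → trans (monomial-*ₚ-+ X-monomial (X ^ₚ m) j) (proj₂ (X^-monomial m) j (1+j≢1+m ∘ cong suc))

[X+c]*ₚ-zero : ∀ c q → ((X +ₚ constP c) *ₚ q) 0 ≡ c * q 0
[X+c]*ₚ-zero c q = cong (_* q 0) (ℚₚ.+-identityˡ c)

[X+c]*ₚ-suc : ∀ c q k → ((X +ₚ constP c) *ₚ q) (suc k) ≡ q k ℚ.+ c * q (suc k)
[X+c]*ₚ-suc c q k = convAux-linear k
  where
  convAux-linear : ∀ i → convAux (X +ₚ constP c) q (suc k) (suc i) ≡ q k ℚ.+ c * q (suc k)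
  convAux-linear zero =
    solve 3 (λ a c b → (con 1ℚ :+ con 0ℚ) :* a :+ (con 0ℚ :+ c) :* b := a :+ c :* b) refl (q k) c (q (suc k))
  convAux-linear (suc i) =
    trans (solve 2 (λ a s → (con 0ℚ :+ con 0ℚ) :* a :+ s := s) refl (q (k ∸ suc i)) (convAux (X +ₚ constP c) q (suc k) (suc i)))
          (convAux-linear i)

binomial-coeff : ∀ m j → ((X +ₚ constP (- 1ℚ)) ^ₚ m) j ≡ ℕ→ℚ (m C j) * sign (m + j)
binomial-coeff zero    zero    = refl
binomial-coeff zero    (suc j) = sym (ℚₚ.*-zeroˡ (sign (suc j)))
binomial-coeff (suc m) zero    = begin
  (L ^ₚ suc m) 0                     ≡⟨ [X+c]*ₚ-zero (- 1ℚ) (L ^ₚ m) ⟩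
  - 1ℚ * (L ^ₚ m) 0                  ≡⟨ cong (- 1ℚ *_) (binomial-coeff m 0) ⟩
  - 1ℚ * (1ℚ * sign (m + 0))         ≡⟨ solve 1 (λ s → :- con 1ℚ :* (con 1ℚ :* s) := con 1ℚ :* (:- s)) refl (sign (m + 0)) ⟩
  1ℚ * sign (suc m + 0)              ∎
  where L = X +ₚ constP (- 1ℚ)
binomial-coeff (suc m) (suc j) = begin
  (L ^ₚ suc m) (suc j)                                     ≡⟨ [X+c]*ₚ-suc (- 1ℚ) (L ^ₚ m) j ⟩
  (L ^ₚ m) j ℚ.+ - 1ℚ * (L ^ₚ m) (suc j)                   ≡⟨ cong₂ (λ x y → x ℚ.+ - 1ℚ * y) (binomial-coeff m j) (binomial-coeff m (suc j)) ⟩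
  a * sign (m + j) ℚ.+ - 1ℚ * (b * sign (m + suc j))       ≡⟨ cong (λ i → a * sign (m + j) ℚ.+ - 1ℚ * (b * sign i)) (ℕₚ.+-suc m j) ⟩
  a * s ℚ.+ - 1ℚ * (b * - s)                               ≡⟨ solve 3 (λ a b s → a :* s :+ :- con 1ℚ :* (b :* :- s) := (a :+ b) :* :- (:- s)) refl a b s ⟩
  (a ℚ.+ b) * - (- s)                                      ≡⟨ cong₂ (λ x i → x * - sign i) pascal (sym (ℕₚ.+-suc m j)) ⟩
  ℕ→ℚ (suc m C suc j) * sign (suc m + suc j)               ∎
  where
  L = X +ₚ constP (- 1ℚ)
  a = ℕ→ℚ (m C j) ; b = ℕ→ℚ (m C suc j) ; s = sign (m + j)
  pascal : a ℚ.+ b ≡ ℕ→ℚ (suc m C suc j)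
  pascal = trans (sym (ℕ→ℚ-homo-+ (m C j) (m C suc j))) (cong ℕ→ℚ (nCk+nC[k+1]≡[n+1]C[k+1] m j))

sumP-≡0 : ∀ N f j → (∀ k → k ≤ N → f k j ≡ 0ℚ) → sumP N f j ≡ 0ℚ
sumP-≡0 zero    f j f≡0 = f≡0 0 z≤n
sumP-≡0 (suc N) f j f≡0 = begin
  sumP N f j ℚ.+ f (suc N) j ≡⟨ cong₂ ℚ._+_ (sumP-≡0 N f j (λ k k≤N → f≡0 k (ℕₚ.m≤n⇒m≤1+n k≤N))) (f≡0 (suc N) ℕₚ.≤-refl) ⟩
  0ℚ ℚ.+ 0ℚ                  ≡⟨ ℚₚ.+-identityʳ 0ℚ ⟩
  0ℚ                         ∎

sumP-single : ∀ N f j {k₀} → k₀ ≤ N → (∀ k → k ≤ N → k ≢ k₀ → f k j ≡ 0ℚ) → sumP N f j ≡ f k₀ j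
sumP-single zero    f j z≤n _ = refl
sumP-single (suc N) f j {k₀} k₀≤1+N others with k₀ ℕ.≟ suc N
... | yes refl = begin
  sumP N f j ℚ.+ f (suc N) j ≡⟨ cong (ℚ._+ f (suc N) j) (sumP-≡0 N f j (λ k k≤N → others k (ℕₚ.m≤n⇒m≤1+n k≤N) (ℕₚ.<⇒≢ (s≤s k≤N)))) ⟩
  0ℚ ℚ.+ f (suc N) j         ≡⟨ ℚₚ.+-identityˡ (f (suc N) j) ⟩
  f (suc N) j                ∎
... | no k₀≢1+N = begin
  sumP N f j ℚ.+ f (suc N) j ≡⟨ cong₂ ℚ._+_ (sumP-single N f j (ℕₚ.≤-pred (ℕₚ.≤∧≢⇒< k₀≤1+N k₀≢1+N)) (λ k k≤N → others k (ℕₚ.m≤n⇒m≤1+n k≤N)))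
                                           (others (suc N) ℕₚ.≤-refl (k₀≢1+N ∘ sym)) ⟩
  f k₀ j ℚ.+ 0ℚ              ≡⟨ ℚₚ.+-identityʳ (f k₀ j) ⟩
  f k₀ j                     ∎

reciprocal-≤ : ∀ {d t} p → t ≤ d → reciprocal d p t ≡ p (d ∸ t)
reciprocal-≤ {d} {t} p t≤d with t ℕ.≤? d
... | yes _   = refl
... | no  t≰d = ⊥-elim (t≰d t≤d)

reciprocal-> : ∀ {d t} p → d < t → reciprocal d p t ≡ 0ℚ
reciprocal-> {d} {t} p d<t with t ℕ.≤? d
... | yes t≤d = ⊥-elim (ℕₚ.<⇒≱ d<t t≤d)
... | no  _   = refl

sCoeff : ℕ → ℕ → ℕ → ℚ
sCoeff r n k = ℕ→ℚ (n C k) * sign k * inv (ℕ→ℚ ((r + k) C r))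

sTerm : ℕ → ℕ → ℕ → Poly
sTerm r n k = sCoeff r n k ·ₚ (X ^ₚ (n ∸ k))

S-coeff-≤ : ∀ r {n j} → j ≤ n → S r n j ≡ sCoeff r n (n ∸ j)
S-coeff-≤ r {n} {j} j≤n = begin
  S r n j                                       ≡⟨ sumP-single n (sTerm r n) j (ℕₚ.m∸n≤m n j) others ⟩
  sCoeff r n (n ∸ j) * (X ^ₚ (n ∸ (n ∸ j))) j   ≡⟨ cong (λ e → sCoeff r n (n ∸ j) * (X ^ₚ e) j) (ℕₚ.m∸[m∸n]≡n j≤n) ⟩
  sCoeff r n (n ∸ j) * (X ^ₚ j) j               ≡⟨ cong (sCoeff r n (n ∸ j) *_) (proj₁ (X^-monomial j)) ⟩
  sCoeff r n (n ∸ j) * 1ℚ                       ≡⟨ ℚₚ.*-identityʳ (sCoeff r n (n ∸ j)) ⟩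
  sCoeff r n (n ∸ j)                            ∎
  where
  others : ∀ k → k ≤ n → k ≢ n ∸ j → sCoeff r n k * (X ^ₚ (n ∸ k)) j ≡ 0ℚ
  others k k≤n k≢n∸j = trans (cong (sCoeff r n k *_) (proj₂ (X^-monomial (n ∸ k)) j j≢n∸k)) (ℚₚ.*-zeroʳ (sCoeff r n k))
    where
    j≢n∸k : j ≢ n ∸ k
    j≢n∸k j≡n∸k = k≢n∸j (trans (sym (ℕₚ.m∸[m∸n]≡n k≤n)) (cong (n ∸_) (sym j≡n∸k)))

S-coeff-> : ∀ r {n j} → n < j → S r n j ≡ 0ℚ
S-coeff-> r {n} {j} n<j = sumP-≡0 n (sTerm r n) j λ k _ →
  trans (cong (sCoeff r n k *_) (proj₂ (X^-monomial (n ∸ k)) j (λ j≡n∸k → ℕₚ.<⇒≱ n<j (subst (_≤ n) (sym j≡n∸k) (ℕₚ.m∸n≤m n k)))))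
        (ℚₚ.*-zeroʳ (sCoeff r n k))

S-leading : ∀ r n → S r n n ≡ 1ℚ
S-leading r n = begin
  S r n n                                         ≡⟨ S-coeff-≤ r (ℕₚ.≤-refl {n}) ⟩
  sCoeff r n (n ∸ n)                              ≡⟨ cong (sCoeff r n) (ℕₚ.n∸n≡0 n) ⟩
  ℕ→ℚ (n C 0) * 1ℚ * inv (ℕ→ℚ ((r + 0) C r))      ≡⟨ cong (λ c → 1ℚ * 1ℚ * inv (ℕ→ℚ c)) (trans (cong (_C r) (ℕₚ.+-identityʳ r)) (nCn≡1 r)) ⟩
  1ℚ * 1ℚ * inv 1ℚ                                ≡⟨ cong (_* inv 1ℚ) (ℚₚ.*-identityʳ 1ℚ) ⟩
  1ℚ * inv 1ℚ                                     ≡⟨ inv-inverseʳ {1ℚ} (λ ()) ⟩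
  1ℚ                                              ∎

sCoeff-closed : ∀ a k m → sCoeff a (k + m) k ≡ sign k * (ℕ→ℚ ((a + (k + m)) C m) * inv (ℕ→ℚ ((a + (k + m)) C a)))
sCoeff-closed a k m = begin
  ℕ→ℚ P * sign k * inv (ℕ→ℚ T)   ≡⟨ cong (_* inv (ℕ→ℚ T)) (ℚₚ.*-comm (ℕ→ℚ P) (sign k)) ⟩
  sign k * ℕ→ℚ P * inv (ℕ→ℚ T)   ≡⟨ ℚₚ.*-assoc (sign k) (ℕ→ℚ P) (inv (ℕ→ℚ T)) ⟩
  sign k * (ℕ→ℚ P * inv (ℕ→ℚ T)) ≡⟨ cong (sign k *_) (*-inv-cross {ℕ→ℚ P} {ℕ→ℚ T} {ℕ→ℚ R} {ℕ→ℚ Q} (ℕ→ℚ-≢0 ([a+b]Ca≢0 a k)) (ℕ→ℚ-≢0 ([a+b]Ca≢0 a (k + m))) cross) ⟩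
  sign k * (ℕ→ℚ R * inv (ℕ→ℚ Q)) ∎
  where
  N = a + (k + m)
  P = (k + m) C k ; Q = N C a ; R = N C m ; T = (a + k) C a
  cross : ℕ→ℚ P * ℕ→ℚ Q ≡ ℕ→ℚ R * ℕ→ℚ T
  cross = trans (sym (ℕ→ℚ-homo-* P Q)) (trans (cong ℕ→ℚ (trinomial a k m)) (ℕ→ℚ-homo-* R T))

-- The coefficient of x^j in T(r,n).
tCoeff : ℕ → ℕ → ℕ → ℚ
tCoeff r n j = sign r * (inv (ℕ→ℚ ((r + n) C r)) * (ℕ→ℚ ((r + n) C j) * sign (r + n + j)))

tCoeff-sign : ∀ r n j → tCoeff r n j ≡ sign r * sign (r + n + j) * (ℕ→ℚ ((r + n) C j) * inv (ℕ→ℚ ((r + n) C r)))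
tCoeff-sign r n j = rearrange (sign r) (inv (ℕ→ℚ ((r + n) C r))) (ℕ→ℚ ((r + n) C j)) (sign (r + n + j))
  where
  rearrange : ∀ s i c t → s * (i * (c * t)) ≡ s * t * (c * i)
  rearrange = solve 4 (λ s i c t → s :* (i :* (c :* t)) := s :* t :* (c :* i)) refl

tCoeff-> : ∀ r n {j} → r + n < j → tCoeff r n j ≡ 0ℚ
tCoeff-> r n {j} r+n<j = begin
  sign r * (i * (ℕ→ℚ ((r + n) C j) * s)) ≡⟨ cong (λ c → sign r * (i * (ℕ→ℚ c * s))) (k>n⇒nCk≡0 r+n<j) ⟩
  sign r * (i * (0ℚ * s))                ≡⟨ cong (λ x → sign r * (i * x)) (ℚₚ.*-zeroˡ s) ⟩
  sign r * (i * 0ℚ)                      ≡⟨ cong (sign r *_) (ℚₚ.*-zeroʳ i) ⟩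
  sign r * 0ℚ                            ≡⟨ ℚₚ.*-zeroʳ (sign r) ⟩
  0ℚ                                     ∎
  where
  i = inv (ℕ→ℚ ((r + n) C r)) ; s = sign (r + n + j)

-- The cases are reached by subst rather than by `with`: abstracting these goals makes the
-- type checker normalise the rational arithmetic inside S and S⋆, which exhausts memory.
S≡tCoeff : ∀ r {n j} → j ≤ n → S r n j ≡ tCoeff r n j
S≡tCoeff r {n} {j} j≤n = subst (λ n → S r n j ≡ tCoeff r n j) (ℕₚ.m∸n+n≡m j≤n) (below (n ∸ j))
  where
  below : ∀ k → S r (k + j) j ≡ tCoeff r (k + j) j
  below k = begin
    S r (k + j) j                              ≡⟨ S-coeff-≤ r (ℕₚ.m≤n+m j k) ⟩
    sCoeff r (k + j) (k + j ∸ j)               ≡⟨ cong (sCoeff r (k + j)) (ℕₚ.m+n∸n≡m k j) ⟩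
    sCoeff r (k + j) k                         ≡⟨ sCoeff-closed r k j ⟩
    sign k * c                                 ≡⟨ cong (_* c) (sym signs) ⟩
    sign r * sign (r + (k + j) + j) * c        ≡⟨ sym (tCoeff-sign r (k + j) j) ⟩
    tCoeff r (k + j) j                         ∎
    where
    c = ℕ→ℚ ((r + (k + j)) C j) * inv (ℕ→ℚ ((r + (k + j)) C r))
    signs : sign r * sign (r + (k + j) + j) ≡ sign k
    signs = trans (cong (λ e → sign r * sign e) reassoc) (sign-parity r k j)
      where
      reassoc : r + (k + j) + j ≡ r + (k + (j + j))
      reassoc = ℕ-Solver.solve (r ∷ k ∷ j ∷ [])

tCoeff-reciprocal : ∀ n {r t} → t ≤ r → tCoeff n r (r ∸ t) ≡ tCoeff r n (n + t)
tCoeff-reciprocal n {r} {t} t≤r = subst (λ r → tCoeff n r (r ∸ t) ≡ tCoeff r n (n + t)) (ℕₚ.m+[n∸m]≡n t≤r) (reflect (r ∸ t))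
  where
  reflect : ∀ m → tCoeff n (t + m) (t + m ∸ t) ≡ tCoeff (t + m) n (n + t)
  reflect m = begin
    tCoeff n (t + m) (t + m ∸ t)                                              ≡⟨ cong (tCoeff n (t + m)) (ℕₚ.m+n∸m≡n t m) ⟩
    tCoeff n (t + m) m                                                        ≡⟨ tCoeff-sign n (t + m) m ⟩
    sign n * sign (n + (t + m) + m) * (ℕ→ℚ (N C m) * inv (ℕ→ℚ (N C n)))       ≡⟨ cong₂ _*_ signs ratios ⟩
    sign (t + m) * sign (t + m + n + (n + t)) * (ℕ→ℚ (N′ C (n + t)) * inv (ℕ→ℚ (N′ C (t + m)))) ≡⟨ sym (tCoeff-sign (t + m) n (n + t)) ⟩
    tCoeff (t + m) n (n + t)                                                  ∎
    where
    N = n + (t + m) ; N′ = t + m + n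
    signs : sign n * sign (n + (t + m) + m) ≡ sign (t + m) * sign (t + m + n + (n + t))
    signs = trans signsˡ (sym signsʳ)
      where
      signsˡ : sign n * sign (n + (t + m) + m) ≡ sign t
      signsˡ = trans (cong (λ e → sign n * sign e) reassocˡ) (sign-parity n t m)
        where
        reassocˡ : n + (t + m) + m ≡ n + (t + (m + m))
        reassocˡ = ℕ-Solver.solve (n ∷ t ∷ m ∷ [])
      signsʳ : sign (t + m) * sign (t + m + n + (n + t)) ≡ sign t
      signsʳ = trans (cong (λ e → sign (t + m) * sign e) reassocʳ) (sign-parity (t + m) t n)
        where
        reassocʳ : t + m + n + (n + t) ≡ t + m + (t + (n + n))
        reassocʳ = ℕ-Solver.solve (t ∷ m ∷ n ∷ [])
    ratios : ℕ→ℚ (N C m) * inv (ℕ→ℚ (N C n)) ≡ ℕ→ℚ (N′ C (n + t)) * inv (ℕ→ℚ (N′ C (t + m)))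
    ratios = cong₂ (λ x y → ℕ→ℚ x * inv (ℕ→ℚ y)) (sym choose-low) (sym choose-r)
      where
      choose-r : N′ C (t + m) ≡ N C n
      choose-r = trans (C-complement (t + m) n refl) (cong (_C n) (ℕₚ.+-comm (t + m) n))
      choose-low : N′ C (n + t) ≡ N C m
      choose-low = trans (C-complement (n + t) m n+t+m≡N′) (cong (_C m) (ℕₚ.+-comm (t + m) n))
        where
        n+t+m≡N′ : n + t + m ≡ t + m + n
        n+t+m≡N′ = ℕ-Solver.solve (n ∷ t ∷ m ∷ [])

x^nS⋆≡tCoeff : ∀ n r {j} → n ≤ j → ((X ^ₚ n) *ₚ S⋆ n r) j ≡ tCoeff r n j
x^nS⋆≡tCoeff n r {j} n≤j = subst (λ j → ((X ^ₚ n) *ₚ S⋆ n r) j ≡ tCoeff r n j) (ℕₚ.m+[n∸m]≡n n≤j) (above (j ∸ n))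
  where
  above : ∀ t → ((X ^ₚ n) *ₚ S⋆ n r) (n + t) ≡ tCoeff r n (n + t)
  above t = [ inside , outside ]′ (ℕₚ.≤-<-connex t r)
    where
    inside : t ≤ r → ((X ^ₚ n) *ₚ S⋆ n r) (n + t) ≡ tCoeff r n (n + t)
    inside t≤r = begin
      ((X ^ₚ n) *ₚ S⋆ n r) (n + t) ≡⟨ monomial-*ₚ-+ (X^-monomial n) (S⋆ n r) t ⟩
      S⋆ n r t                     ≡⟨ reciprocal-≤ (S n r) t≤r ⟩
      S n r (r ∸ t)                ≡⟨ S≡tCoeff n (ℕₚ.m∸n≤m r t) ⟩
      tCoeff n r (r ∸ t)           ≡⟨ tCoeff-reciprocal n t≤r ⟩
      tCoeff r n (n + t)           ∎
    outside : r < t → ((X ^ₚ n) *ₚ S⋆ n r) (n + t) ≡ tCoeff r n (n + t)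
    outside r<t = begin
      ((X ^ₚ n) *ₚ S⋆ n r) (n + t) ≡⟨ monomial-*ₚ-+ (X^-monomial n) (S⋆ n r) t ⟩
      S⋆ n r t                     ≡⟨ reciprocal-> (S n r) r<t ⟩
      0ℚ                           ≡⟨ sym (tCoeff-> r n (subst (_< n + t) (ℕₚ.+-comm n r) (ℕₚ.+-monoʳ-< n r<t))) ⟩
      tCoeff r n (n + t)           ∎

S+x^nS⋆≡tCoeff+x^n : ∀ n r j → S r n j ℚ.+ ((X ^ₚ n) *ₚ S⋆ n r) j ≡ tCoeff r n j ℚ.+ (X ^ₚ n) j
S+x^nS⋆≡tCoeff+x^n n r j = by-order (ℕₚ.<-cmp j n)
  where
  by-order : Tri (j < n) (j ≡ n) (n < j) → S r n j ℚ.+ ((X ^ₚ n) *ₚ S⋆ n r) j ≡ tCoeff r n j ℚ.+ (X ^ₚ n) j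
  by-order (tri< j<n _ _) = cong₂ ℚ._+_ (S≡tCoeff r (ℕₚ.<⇒≤ j<n))
    (trans (monomial-*ₚ-< (X^-monomial n) (S⋆ n r) j<n) (sym (proj₂ (X^-monomial n) j (ℕₚ.<⇒≢ j<n))))
  by-order (tri≈ _ j≡n _) = subst (λ i → S r n i ℚ.+ ((X ^ₚ n) *ₚ S⋆ n r) i ≡ tCoeff r n i ℚ.+ (X ^ₚ n) i) (sym j≡n)
    (cong₂ ℚ._+_ (S≡tCoeff r (ℕₚ.≤-refl {n})) (begin
      ((X ^ₚ n) *ₚ S⋆ n r) n ≡⟨ x^nS⋆≡tCoeff n r (ℕₚ.≤-refl {n}) ⟩
      tCoeff r n n           ≡⟨ sym (S≡tCoeff r (ℕₚ.≤-refl {n})) ⟩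
      S r n n                ≡⟨ S-leading r n ⟩
      1ℚ                     ≡⟨ sym (proj₁ (X^-monomial n)) ⟩
      (X ^ₚ n) n             ∎))
  by-order (tri> _ _ n<j) = begin
    S r n j ℚ.+ ((X ^ₚ n) *ₚ S⋆ n r) j ≡⟨ cong₂ ℚ._+_ (S-coeff-> r n<j) (x^nS⋆≡tCoeff n r (ℕₚ.<⇒≤ n<j)) ⟩
    0ℚ ℚ.+ tCoeff r n j                 ≡⟨ ℚₚ.+-comm 0ℚ (tCoeff r n j) ⟩
    tCoeff r n j ℚ.+ 0ℚ                 ≡⟨ cong (tCoeff r n j ℚ.+_) (sym (proj₂ (X^-monomial n) j (ℕₚ.>⇒≢ n<j))) ⟩
    tCoeff r n j ℚ.+ (X ^ₚ n) j         ∎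

theorem2p5 : (n r : ℕ) → n ≥ 1 → r ≥ 1 →
    (S r n +ₚ ((X ^ₚ n) *ₚ S⋆ n r))
      ≈ₚ ((sign r ·ₚ ((inv (ℕ→ℚ ((r + n) C r)) ·ₚ ((X +ₚ constP (- 1ℚ)) ^ₚ (r + n))))) +ₚ (X ^ₚ n))
theorem2p5 n r _ _ j = begin
  S r n j ℚ.+ ((X ^ₚ n) *ₚ S⋆ n r) j                                                   ≡⟨ S+x^nS⋆≡tCoeff+x^n n r j ⟩
  tCoeff r n j ℚ.+ (X ^ₚ n) j                                                           ≡⟨ cong (λ c → sign r * (inv (ℕ→ℚ ((r + n) C r)) * c) ℚ.+ (X ^ₚ n) j)
                                                                                             (sym (binomial-coeff (r + n) j)) ⟩
  sign r * (inv (ℕ→ℚ ((r + n) C r)) * ((X +ₚ constP (- 1ℚ)) ^ₚ (r + n)) j) ℚ.+ (X ^ₚ n) j ∎
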